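{- Let $p$ be a prime, $\Gamma$ a multiplicative subgroup of $\mathbb{F}_p^*$, and $g=\begin{pmatrix} a & b\\ c& d\end{pmatrix}\in {\rm GL}_2(\mathbb{F}_p)$ with $c\neq0$. Let $k\geqslant 2$, $\alpha_1,\dots,\alpha_k\in\mathbb{F}_p^*$ and $\beta_1,\dots,\beta_k\in\mathbb{F}_p$, with $\beta_1=g^{ -1}(\infty)=-d/c$ and $\beta_j\neq -d/c$ for $j\geqslant 2$. Then $$g\,\Gamma_{\alpha_1,\dots,\alpha_k;\,\beta_1,\dots,\beta_k}=\Gamma_{\gamma_1,\dots,\gamma_k;\, g(\infty), g(\beta_2),\dots,g(\beta_k)},$$ where $\gamma_1=-\frac{\det(g)}{c^2\alpha_1}$ and $\gamma_j=\frac{\alpha_j\det(g)}{\alpha_1 c(c\beta_j+d)}$ for $j\in\{2,\dots,k\}$.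
   Context: For $\alpha_1,\dots,\alpha_k\in\mathbb{F}_p^*$ and $\beta_1,\dots,\beta_k\in\mathbb{F}_p$, $\Gamma_{\alpha_1,\dots,\alpha_k;\beta_1,\dots,\beta_k}=(\alpha_1\Gamma+\beta_1)\cap\dots\cap(\alpha_k\Gamma+\beta_k)$, where $\alpha\Gamma+\beta=\{\alpha x+\beta: x\in\Gamma\}$. The matrix $g$ acts on $\mathbb{F}_p\cup\{\infty\}$ by $g(z)=\frac{az+b}{cz+d}$, so $g(\infty)=a/c$, and $gX=\{g(x):x\in X\}$. -}

module Defs where

open import Data.Nat as ℕ using (ℕ; zero; suc; NonZero; _∸_)
open import Data.Nat.DivMod using (_mod_)
open import Data.Fin as Fin using (Fin; toℕ)
open import Data.Maybe using (Maybe; just; nothing)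
open import Data.Product using (∃; _×_)
open import Data.Bool using (if_then_else_)
open import Relation.Nullary using (¬_; does)
open import Relation.Binary.PropositionalEquality using (_≡_)

module Field (p : ℕ) .{{_ : NonZero p}} where

  F : Set
  F = Fin p

  0F 1F : F
  0F = 0 mod p
  1F = 1 mod p

  infixl 6 _+F_ _-F_
  infixl 7 _*F_ _/F_

  _+F_ _*F_ _-F_ _/F_ : F → F → F
  x +F y = (toℕ x ℕ.+ toℕ y) mod p
  x *F y = (toℕ x ℕ.* toℕ y) mod p

  negF : F → F
  negF x = (p ∸ toℕ x) mod p

  x -F y = x +F negF y

  -- multiplicative inverse via Fermat: x⁻¹ = x^(p-2)  (p prime; 0⁻¹ = 0)
  invF : F → F
  invF x = (toℕ x ℕ.^ (p ∸ 2)) mod p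

  x /F y = x *F invF y

  _≟F_ = Fin._≟_ {p}

  record IsMulSubgroup (Γ : F → Set) : Set where
    field
      zero∉ : ¬ Γ 0F
      one∈  : Γ 1F
      *-closed   : ∀ {x y} → Γ x → Γ y → Γ (x *F y)
      inv-closed : ∀ {x} → Γ x → Γ (invF x)

  GammaSet : (Γ : F → Set) {k : ℕ} → (Fin k → F) → (Fin k → F) → F → Set
  GammaSet Γ α β x = ∀ i → ∃ λ y → Γ y × (x ≡ α i *F y +F β i)

  -- the projective line F_p ∪ {∞}; nothing = ∞
  P¹ : Set
  P¹ = Maybe F

  record Mat : Set where
    constructor mat
    field a b c d : F

  det : Mat → F
  det (mat a b c d) = a *F d -F b *F c

  -- (a z + b)/(c z + d) computed in F_p (used at finite points with c z + d ≠ 0)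
  möb : Mat → F → F
  möb (mat a b c d) z = (a *F z +F b) /F (c *F z +F d)

  act : Mat → P¹ → P¹
  act (mat a b c d) nothing =
    if does (c ≟F 0F) then nothing else just (a /F c)
  act g@(mat a b c d) (just z) =
    if does ((c *F z +F d) ≟F 0F) then nothing else just (möb g z)

  image : Mat → (F → Set) → P¹ → Set
  image g X w = ∃ λ x → X x × (act g (just x) ≡ w)

  embed : (F → Set) → P¹ → Set
  embed X w = ∃ λ y → X y × (just y ≡ w)

  -- the new dilation factors γ_j and shifts g(∞), g(β_2), …, g(β_k)
  -- (index zero of Fin (suc m) is the paper's index 1)
  gammaCoeffs : Mat → {m : ℕ} → (Fin (suc m) → F) → (Fin (suc m) → F) → Fin (suc m) → F
  gammaCoeffs g@(mat a b c d) α β Fin.zero = negF (det g /F (c *F c *F α Fin.zero))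
  gammaCoeffs g@(mat a b c d) α β (Fin.suc j) =
    (α (Fin.suc j) *F det g) /F (α Fin.zero *F c *F (c *F β (Fin.suc j) +F d))

  newShifts : Mat → {m : ℕ} → (Fin (suc m) → F) → Fin (suc m) → F
  newShifts (mat a b c d) β Fin.zero = a /F c
  newShifts g β (Fin.suc j) = möb g (β (Fin.suc j))

-- For c ≠ 0 a Möbius map satisfies g(z) = g(∞) − det g / (c (cz + d)) and
-- g(z) − g(w) = det g · (z − w) / ((cz + d)(cw + d)). Every point of Γ_{α;β} is x = α₁y + β₁ = α₁y − d/c
-- with y ∈ Γ, so cx + d = cα₁y ≠ 0; the first formula then gives g(x) = γ₁y⁻¹ + g(∞), and whenever
-- x = α_j y_j + β_j the second gives g(x) = γ_j (y_j y⁻¹) + g(β_j). As y ↦ y⁻¹ and y_j ↦ y_j y⁻¹ preserve Γ,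
-- this is one inclusion; read backwards from y = y₁′⁻¹ (γ_j ≠ 0 allows cancelling) it is the other.
-- Division in F_p is x ↦ x^(p−2), an inverse of x ≠ 0 by Fermat's little theorem, which follows from the
-- binomial theorem because p divides the inner binomial coefficients (p choose k).
{-# OPTIONS --safe #-}
module Submission where

open import Defs
open import Data.Bool using (if_then_else_)
open import Data.Fin as Fin using (Fin; zero; suc; toℕ)
open import Data.Fin.Properties using (toℕ-injective; toℕ-fromℕ<; toℕ<n; toℕ-inject₁; toℕ-fromℕ)
open import Data.Integer as ℤ using (ℤ; +_; -[1+_]; _⊖_)
import Data.Integer.Properties as ℤ
open import Data.Maybe using (Maybe; just; nothing)
open import Data.Nat as ℕ using (ℕ; zero; suc; NonZero; nonTrivial⇒n>1; _≤_; _<_; _∸_; _%_; z≤n; s≤s)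
import Data.Nat.Properties as ℕ
open import Data.Nat.Combinatorics using (_C_; nCn≡1; k![n∸k]!∣n!)
open import Data.Nat.Combinatorics.Specification using (nCk≡n!/k![n-k]!)
open import Data.Nat.Divisibility using (_∣_; _∤_; ∣⇒≤; m∣m*n; n∣m⇒m%n≡0; m%n≡0⇒n∣m)
open import Data.Nat.DivMod
  using (_mod_; m%n<n; m<n⇒m%n≡m; %-distribˡ-+; %-distribˡ-*; n%n≡0; m*n%n≡0; m/n*n≡m)
open import Data.Nat.Primality using (Prime; euclidsLemma; prime⇒nonTrivial)
open import Data.Product using (_,_)
open import Data.Sign as Sign using (Sign)
open import Data.Sum using (_⊎_; inj₁; inj₂)
open import Function using (_∘_)
open import Function.Bundles using (_⇔_; mk⇔)
open import Relation.Binary.PropositionalEquality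
open import Relation.Nullary using (yes; no; contradiction)
open import Relation.Nullary.Decidable using (dec-false)
open import Algebra.Bundles using (CommutativeRing)
open import Algebra.Structures using (IsCommutativeRing)
import Algebra.Properties.Ring as RingProperties
import Algebra.Solver.Ring as RingSolver
import Algebra.Solver.Ring.AlmostCommutativeRing as AlmostCommutativeRing

C*k![n∸k]!≡n! : ∀ {n k} → k ≤ n → (n C k) ℕ.* (k ℕ.! ℕ.* (n ∸ k) ℕ.!) ≡ n ℕ.!
C*k![n∸k]!≡n! {n} {k} k≤n = trans (cong (ℕ._* (k ℕ.! ℕ.* (n ∸ k) ℕ.!)) (nCk≡n!/k![n-k]! k≤n))
                                  (m/n*n≡m (k![n∸k]!∣n! k≤n))
  where instance _ = ℕ._!*_!≢0 k (n ∸ k)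

prime∤m! : ∀ {p} → Prime p → ∀ m → m < p → p ∤ m ℕ.!
prime∤m! p-prime zero    _   p∣1 = ℕ.<⇒≱ (nonTrivial⇒n>1 _ {{prime⇒nonTrivial p-prime}}) (∣⇒≤ p∣1)
prime∤m! p-prime (suc m) m<p p∣m! with euclidsLemma (suc m) (m ℕ.!) p-prime p∣m!
... | inj₁ p∣1+m = ℕ.<⇒≱ m<p (∣⇒≤ p∣1+m)
... | inj₂ p∣m!  = prime∤m! p-prime m (ℕ.<-trans (ℕ.n<1+n m) m<p) p∣m!

prime∣pCk : ∀ {p k} → Prime p → 0 < k → k < p → p ∣ p C k
prime∣pCk {p@(suc n)} {k} p-prime 0<k k<p
  with euclidsLemma (p C k) (k ℕ.! ℕ.* (p ∸ k) ℕ.!) p-prime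
         (subst (p ∣_) (sym (C*k![n∸k]!≡n! (ℕ.<⇒≤ k<p))) (m∣m*n (n ℕ.!)))
... | inj₁ p∣C = p∣C
... | inj₂ p∣k![p∸k]! with euclidsLemma (k ℕ.!) ((p ∸ k) ℕ.!) p-prime p∣k![p∸k]!
...   | inj₁ p∣k!     = contradiction p∣k! (prime∤m! p-prime k k<p)
...   | inj₂ p∣[p∸k]! = contradiction p∣[p∸k]! (prime∤m! p-prime (p ∸ k) (ℕ.∸-monoʳ-< 0<k (ℕ.<⇒≤ k<p)))

module IntegersModulo (p : ℕ) .{{_ : NonZero p}} where
  open Field p
  open ≡-Reasoning

  ⟦_⟧ : ℕ → F
  ⟦ n ⟧ = n mod p

  toℕ-⟦⟧ : ∀ n → toℕ ⟦ n ⟧ ≡ n % p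
  toℕ-⟦⟧ n = toℕ-fromℕ< (m%n<n n p)

  ⟦⟧-toℕ : ∀ x → ⟦ toℕ x ⟧ ≡ x
  ⟦⟧-toℕ x = toℕ-injective (trans (toℕ-⟦⟧ (toℕ x)) (m<n⇒m%n≡m (toℕ<n x)))

  ⟦⟧-cong-% : ∀ {m n} → m % p ≡ n % p → ⟦ m ⟧ ≡ ⟦ n ⟧
  ⟦⟧-cong-% {m} {n} eq = toℕ-injective (trans (toℕ-⟦⟧ m) (trans eq (sym (toℕ-⟦⟧ n))))

  ⟦⟧-+ : ∀ m n → ⟦ m ℕ.+ n ⟧ ≡ ⟦ m ⟧ +F ⟦ n ⟧
  ⟦⟧-+ m n = ⟦⟧-cong-% (begin
    (m ℕ.+ n) % p                           ≡⟨ %-distribˡ-+ m n p ⟩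
    (m % p ℕ.+ n % p) % p                   ≡⟨ cong₂ (λ u v → (u ℕ.+ v) % p) (toℕ-⟦⟧ m) (toℕ-⟦⟧ n) ⟨
    (toℕ ⟦ m ⟧ ℕ.+ toℕ ⟦ n ⟧) % p           ∎)

  ⟦⟧-* : ∀ m n → ⟦ m ℕ.* n ⟧ ≡ ⟦ m ⟧ *F ⟦ n ⟧
  ⟦⟧-* m n = ⟦⟧-cong-% (begin
    (m ℕ.* n) % p                           ≡⟨ %-distribˡ-* m n p ⟩
    (m % p ℕ.* (n % p)) % p                 ≡⟨ cong₂ (λ u v → (u ℕ.* v) % p) (toℕ-⟦⟧ m) (toℕ-⟦⟧ n) ⟨
    (toℕ ⟦ m ⟧ ℕ.* toℕ ⟦ n ⟧) % p           ∎)

  ⟦⟧-elim₃ : (P : F → F → F → Set) → (∀ m n k → P ⟦ m ⟧ ⟦ n ⟧ ⟦ k ⟧) → ∀ x y z → P x y z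
  ⟦⟧-elim₃ P P⟦⟧ x y z =
    subst₂ (λ u v → P u v z) (⟦⟧-toℕ x) (⟦⟧-toℕ y) (subst (P _ _) (⟦⟧-toℕ z) (P⟦⟧ _ _ _))

  +F-assoc : ∀ x y z → (x +F y) +F z ≡ x +F (y +F z)
  +F-assoc = ⟦⟧-elim₃ _ λ m n k → begin
    (⟦ m ⟧ +F ⟦ n ⟧) +F ⟦ k ⟧  ≡⟨ cong (_+F ⟦ k ⟧) (⟦⟧-+ m n) ⟨
    ⟦ m ℕ.+ n ⟧ +F ⟦ k ⟧       ≡⟨ ⟦⟧-+ (m ℕ.+ n) k ⟨
    ⟦ m ℕ.+ n ℕ.+ k ⟧          ≡⟨ cong ⟦_⟧ (ℕ.+-assoc m n k) ⟩
    ⟦ m ℕ.+ (n ℕ.+ k) ⟧        ≡⟨ ⟦⟧-+ m (n ℕ.+ k) ⟩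
    ⟦ m ⟧ +F ⟦ n ℕ.+ k ⟧       ≡⟨ cong (⟦ m ⟧ +F_) (⟦⟧-+ n k) ⟩
    ⟦ m ⟧ +F (⟦ n ⟧ +F ⟦ k ⟧)  ∎

  *F-assoc : ∀ x y z → (x *F y) *F z ≡ x *F (y *F z)
  *F-assoc = ⟦⟧-elim₃ _ λ m n k → begin
    (⟦ m ⟧ *F ⟦ n ⟧) *F ⟦ k ⟧  ≡⟨ cong (_*F ⟦ k ⟧) (⟦⟧-* m n) ⟨
    ⟦ m ℕ.* n ⟧ *F ⟦ k ⟧       ≡⟨ ⟦⟧-* (m ℕ.* n) k ⟨
    ⟦ m ℕ.* n ℕ.* k ⟧          ≡⟨ cong ⟦_⟧ (ℕ.*-assoc m n k) ⟩
    ⟦ m ℕ.* (n ℕ.* k) ⟧        ≡⟨ ⟦⟧-* m (n ℕ.* k) ⟩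
    ⟦ m ⟧ *F ⟦ n ℕ.* k ⟧       ≡⟨ cong (⟦ m ⟧ *F_) (⟦⟧-* n k) ⟩
    ⟦ m ⟧ *F (⟦ n ⟧ *F ⟦ k ⟧)  ∎

  *F-distribˡ-+F : ∀ x y z → x *F (y +F z) ≡ x *F y +F x *F z
  *F-distribˡ-+F = ⟦⟧-elim₃ _ λ m n k → begin
    ⟦ m ⟧ *F (⟦ n ⟧ +F ⟦ k ⟧)            ≡⟨ cong (⟦ m ⟧ *F_) (⟦⟧-+ n k) ⟨
    ⟦ m ⟧ *F ⟦ n ℕ.+ k ⟧                 ≡⟨ ⟦⟧-* m (n ℕ.+ k) ⟨
    ⟦ m ℕ.* (n ℕ.+ k) ⟧                  ≡⟨ cong ⟦_⟧ (ℕ.*-distribˡ-+ m n k) ⟩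
    ⟦ m ℕ.* n ℕ.+ m ℕ.* k ⟧              ≡⟨ ⟦⟧-+ (m ℕ.* n) (m ℕ.* k) ⟩
    ⟦ m ℕ.* n ⟧ +F ⟦ m ℕ.* k ⟧           ≡⟨ cong₂ _+F_ (⟦⟧-* m n) (⟦⟧-* m k) ⟩
    ⟦ m ⟧ *F ⟦ n ⟧ +F ⟦ m ⟧ *F ⟦ k ⟧     ∎

  +F-comm : ∀ x y → x +F y ≡ y +F x
  +F-comm x y = cong ⟦_⟧ (ℕ.+-comm (toℕ x) (toℕ y))

  *F-comm : ∀ x y → x *F y ≡ y *F x
  *F-comm x y = cong ⟦_⟧ (ℕ.*-comm (toℕ x) (toℕ y))

  +F-identityˡ : ∀ x → 0F +F x ≡ x
  +F-identityˡ x = begin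
    0F +F x          ≡⟨ cong (0F +F_) (⟦⟧-toℕ x) ⟨
    ⟦ 0 ⟧ +F ⟦ toℕ x ⟧ ≡⟨ ⟦⟧-+ 0 (toℕ x) ⟨
    ⟦ toℕ x ⟧        ≡⟨ ⟦⟧-toℕ x ⟩
    x                ∎

  *F-identityˡ : ∀ x → 1F *F x ≡ x
  *F-identityˡ x = begin
    1F *F x            ≡⟨ cong (1F *F_) (⟦⟧-toℕ x) ⟨
    ⟦ 1 ⟧ *F ⟦ toℕ x ⟧ ≡⟨ ⟦⟧-* 1 (toℕ x) ⟨
    ⟦ 1 ℕ.* toℕ x ⟧    ≡⟨ cong ⟦_⟧ (ℕ.*-identityˡ (toℕ x)) ⟩
    ⟦ toℕ x ⟧          ≡⟨ ⟦⟧-toℕ x ⟩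
    x                  ∎

  +F-inverseʳ : ∀ x → x +F negF x ≡ 0F
  +F-inverseʳ x = begin
    x +F negF x                  ≡⟨ cong (_+F negF x) (⟦⟧-toℕ x) ⟨
    ⟦ toℕ x ⟧ +F ⟦ p ∸ toℕ x ⟧   ≡⟨ ⟦⟧-+ (toℕ x) (p ∸ toℕ x) ⟨
    ⟦ toℕ x ℕ.+ (p ∸ toℕ x) ⟧    ≡⟨ cong ⟦_⟧ (ℕ.m+[n∸m]≡n (ℕ.<⇒≤ (toℕ<n x))) ⟩
    ⟦ p ⟧                        ≡⟨ ⟦⟧-cong-% (trans (n%n≡0 p) (sym (m*n%n≡0 0 p))) ⟩
    ⟦ 0 ⟧                        ∎

  +-*-isCommutativeRing : IsCommutativeRing _≡_ _+F_ _*F_ negF 0F 1F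
  +-*-isCommutativeRing = record
    { isRing = record
      { +-isAbelianGroup = record
        { isGroup = record
          { isMonoid = record
            { isSemigroup = record
              { isMagma = record { isEquivalence = isEquivalence ; ∙-cong = cong₂ _+F_ }
              ; assoc = +F-assoc }
            ; identity = +F-identityˡ , λ x → trans (+F-comm x 0F) (+F-identityˡ x) }
          ; inverse = (λ x → trans (+F-comm (negF x) x) (+F-inverseʳ x)) , +F-inverseʳ
          ; ⁻¹-cong = cong negF }
        ; comm = +F-comm }
      ; *-cong = cong₂ _*F_
      ; *-assoc = *F-assoc
      ; *-identity = *F-identityˡ , λ x → trans (*F-comm x 1F) (*F-identityˡ x)
      ; distrib = *F-distribˡ-+F
                , λ x y z → trans (*F-comm (y +F z) x)
                    (trans (*F-distribˡ-+F x y z) (cong₂ _+F_ (*F-comm x y) (*F-comm x z))) }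
    ; *-comm = *F-comm }

  commutativeRing : CommutativeRing _ _
  commutativeRing = record { isCommutativeRing = +-*-isCommutativeRing }

  open CommutativeRing commutativeRing using (+-identityʳ)
  open RingProperties (CommutativeRing.ring commutativeRing)
    using (-0#≈0#; -‿involutive; -‿+-comm; -‿distribˡ-*; -‿distribʳ-*)
  open import Algebra.Properties.CommutativeSemigroup
    (CommutativeRing.+-commutativeSemigroup commutativeRing) using (interchange)

  +F-cancelˡ-−F : ∀ z x y → (z +F x) -F (z +F y) ≡ x -F y
  +F-cancelˡ-−F z x y = begin
    (z +F x) +F negF (z +F y)          ≡⟨ cong ((z +F x) +F_) (-‿+-comm z y) ⟨
    (z +F x) +F (negF z +F negF y)     ≡⟨ interchange z x (negF z) (negF y) ⟩
    (z +F negF z) +F (x -F y)          ≡⟨ cong (_+F (x -F y)) (+F-inverseʳ z) ⟩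
    0F +F (x -F y)                     ≡⟨ +F-identityˡ (x -F y) ⟩
    x -F y                             ∎

  fromℤ : ℤ → F
  fromℤ (+ n)     = ⟦ n ⟧
  fromℤ -[1+ n ]  = negF ⟦ suc n ⟧

  fromℤ-⊖ : ∀ m n → fromℤ (m ⊖ n) ≡ ⟦ m ⟧ -F ⟦ n ⟧
  fromℤ-⊖ zero    zero    = sym (+F-inverseʳ 0F)
  fromℤ-⊖ zero    (suc n) = sym (+F-identityˡ _)
  fromℤ-⊖ (suc m) zero    = sym (trans (cong (⟦ suc m ⟧ +F_) -0#≈0#) (+-identityʳ ⟦ suc m ⟧))
  fromℤ-⊖ (suc m) (suc n) = begin
    fromℤ (suc m ⊖ suc n)          ≡⟨ cong fromℤ (ℤ.[1+m]⊖[1+n]≡m⊖n m n) ⟩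
    fromℤ (m ⊖ n)                  ≡⟨ fromℤ-⊖ m n ⟩
    ⟦ m ⟧ -F ⟦ n ⟧                  ≡⟨ +F-cancelˡ-−F ⟦ 1 ⟧ ⟦ m ⟧ ⟦ n ⟧ ⟨
    (⟦ 1 ⟧ +F ⟦ m ⟧) -F (⟦ 1 ⟧ +F ⟦ n ⟧) ≡⟨ cong₂ _-F_ (⟦⟧-+ 1 m) (⟦⟧-+ 1 n) ⟨
    ⟦ suc m ⟧ -F ⟦ suc n ⟧          ∎

  fromℤ-+ : ∀ i j → fromℤ (i ℤ.+ j) ≡ fromℤ i +F fromℤ j
  fromℤ-+ (+ m)     (+ n)     = ⟦⟧-+ m n
  fromℤ-+ (+ m)     -[1+ n ]  = fromℤ-⊖ m (suc n)
  fromℤ-+ -[1+ m ]  (+ n)     = trans (fromℤ-⊖ n (suc m)) (+F-comm ⟦ n ⟧ _)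
  fromℤ-+ -[1+ m ]  -[1+ n ]  = begin
    negF ⟦ suc (suc (m ℕ.+ n)) ⟧         ≡⟨ cong (λ k → negF ⟦ suc k ⟧) (ℕ.+-suc m n) ⟨
    negF ⟦ suc m ℕ.+ suc n ⟧             ≡⟨ cong negF (⟦⟧-+ (suc m) (suc n)) ⟩
    negF (⟦ suc m ⟧ +F ⟦ suc n ⟧)         ≡⟨ -‿+-comm ⟦ suc m ⟧ ⟦ suc n ⟧ ⟨
    negF ⟦ suc m ⟧ +F negF ⟦ suc n ⟧      ∎

  signed : Sign → F → F
  signed Sign.+ x = x
  signed Sign.- x = negF x

  fromℤ-◃ : ∀ s n → fromℤ (s ℤ.◃ n) ≡ signed s ⟦ n ⟧
  fromℤ-◃ Sign.+ zero    = refl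
  fromℤ-◃ Sign.- zero    = sym -0#≈0#
  fromℤ-◃ Sign.+ (suc n) = refl
  fromℤ-◃ Sign.- (suc n) = refl

  signed-* : ∀ s t x y → signed (s Sign.* t) (x *F y) ≡ signed s x *F signed t y
  signed-* Sign.+ Sign.+ x y = refl
  signed-* Sign.+ Sign.- x y = -‿distribʳ-* x y
  signed-* Sign.- Sign.+ x y = -‿distribˡ-* x y
  signed-* Sign.- Sign.- x y = begin
    x *F y                 ≡⟨ -‿involutive (x *F y) ⟨
    negF (negF (x *F y))   ≡⟨ cong negF (-‿distribˡ-* x y) ⟩
    negF (negF x *F y)     ≡⟨ -‿distribʳ-* (negF x) y ⟩
    negF x *F negF y       ∎

  fromℤ-signAbs : ∀ i → fromℤ i ≡ signed (ℤ.sign i) ⟦ ℤ.∣ i ∣ ⟧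
  fromℤ-signAbs (+ n)    = refl
  fromℤ-signAbs -[1+ n ] = refl

  fromℤ-* : ∀ i j → fromℤ (i ℤ.* j) ≡ fromℤ i *F fromℤ j
  fromℤ-* i j = begin
    fromℤ (s ℤ.◃ ℤ.∣ i ∣ ℕ.* ℤ.∣ j ∣)       ≡⟨ fromℤ-◃ s (ℤ.∣ i ∣ ℕ.* ℤ.∣ j ∣) ⟩
    signed s ⟦ ℤ.∣ i ∣ ℕ.* ℤ.∣ j ∣ ⟧        ≡⟨ cong (signed s) (⟦⟧-* ℤ.∣ i ∣ ℤ.∣ j ∣) ⟩
    signed s (⟦ ℤ.∣ i ∣ ⟧ *F ⟦ ℤ.∣ j ∣ ⟧)    ≡⟨ signed-* (ℤ.sign i) (ℤ.sign j) _ _ ⟩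
    signed (ℤ.sign i) ⟦ ℤ.∣ i ∣ ⟧ *F signed (ℤ.sign j) ⟦ ℤ.∣ j ∣ ⟧
                                            ≡⟨ cong₂ _*F_ (fromℤ-signAbs i) (fromℤ-signAbs j) ⟨
    fromℤ i *F fromℤ j                      ∎
    where s = ℤ.sign i Sign.* ℤ.sign j

  fromℤ-neg : ∀ i → fromℤ (ℤ.- i) ≡ negF (fromℤ i)
  fromℤ-neg (+ zero)  = sym -0#≈0#
  fromℤ-neg (+ suc n) = refl
  fromℤ-neg -[1+ n ]  = sym (-‿involutive _)

  almostCommutativeRing : AlmostCommutativeRing.AlmostCommutativeRing _ _
  almostCommutativeRing = AlmostCommutativeRing.fromCommutativeRing commutativeRing

  fromℤ-morphism : AlmostCommutativeRing._-Raw-AlmostCommutative⟶_ ℤ.+-*-rawRing almostCommutativeRing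
  fromℤ-morphism = record
    { ⟦_⟧ = fromℤ ; +-homo = fromℤ-+ ; *-homo = fromℤ-* ; -‿homo = fromℤ-neg
    ; 0-homo = refl ; 1-homo = refl }

  fromℤ-≟ : ∀ i j → Maybe (fromℤ i ≡ fromℤ j)
  fromℤ-≟ i j with i ℤ.≟ j
  ... | yes i≡j = just (cong fromℤ i≡j)
  ... | no _    = nothing

  -- Coefficients live in ℤ, where equality is decidable, so that the solver can cancel terms.
  module Solver = RingSolver ℤ.+-*-rawRing almostCommutativeRing fromℤ-morphism fromℤ-≟

  ∣⇒⟦⟧≡0F : ∀ {n} → p ∣ n → ⟦ n ⟧ ≡ 0F
  ∣⇒⟦⟧≡0F {n} p∣n = ⟦⟧-cong-% (trans (n∣m⇒m%n≡0 n p p∣n) (sym (m*n%n≡0 0 p)))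

  ⟦⟧≡0F⇒∣ : ∀ {n} → ⟦ n ⟧ ≡ 0F → p ∣ n
  ⟦⟧≡0F⇒∣ {n} ⟦n⟧≡0 =
    m%n≡0⇒n∣m n p (trans (sym (toℕ-⟦⟧ n))
                  (trans (cong toℕ ⟦n⟧≡0) (trans (toℕ-⟦⟧ 0) (m*n%n≡0 0 p))))

  open CommutativeRing commutativeRing using (semiring; zeroˡ; distribʳ)
  open import Algebra.Properties.Semiring.Exp semiring public using (_^_)
  open import Algebra.Properties.Semiring.Mult semiring using (_×_)
  open import Algebra.Properties.Semiring.Sum semiring
    using (sum; sum-init-last; sum-cong-≗; sum-replicate-zero)
  open import Algebra.Properties.Semiring.Binomial semiring using (binomialTerm)
  open import Algebra.Properties.CommutativeSemiring.Binomial
    (CommutativeRing.commutativeSemiring commutativeRing) using (theorem)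

  ×-⟦⟧ : ∀ n x → n × x ≡ ⟦ n ⟧ *F x
  ×-⟦⟧ zero    x = sym (zeroˡ x)
  ×-⟦⟧ (suc n) x = begin
    x +F n × x                   ≡⟨ cong₂ _+F_ (sym (*F-identityˡ x)) (×-⟦⟧ n x) ⟩
    1F *F x +F ⟦ n ⟧ *F x         ≡⟨ distribʳ x 1F ⟦ n ⟧ ⟨
    (1F +F ⟦ n ⟧) *F x            ≡⟨ cong (_*F x) (⟦⟧-+ 1 n) ⟨
    ⟦ suc n ⟧ *F x                ∎

  ⟦⟧-^ : ∀ m k → ⟦ m ℕ.^ k ⟧ ≡ ⟦ m ⟧ ^ k
  ⟦⟧-^ m zero    = refl
  ⟦⟧-^ m (suc k) = trans (⟦⟧-* m (m ℕ.^ k)) (cong (⟦ m ⟧ *F_) (⟦⟧-^ m k))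

  1F^ : ∀ n → 1F ^ n ≡ 1F
  1F^ zero    = refl
  1F^ (suc n) = trans (cong (1F *F_) (1F^ n)) (*F-identityˡ 1F)

  freshmans-dream : ∀ n .{{_ : NonZero n}} → (∀ k → 0 < k → k < n → p ∣ n C k) →
                    ∀ x → (x +F 1F) ^ n ≡ x ^ n +F 1F
  freshmans-dream n@(suc q) p∣C x = begin
    (x +F 1F) ^ n                                       ≡⟨ theorem n x 1F ⟩
    t zero +F sum (t ∘ suc)                             ≡⟨ cong (t zero +F_) (sum-init-last (t ∘ suc)) ⟩
    t zero +F (sum (t ∘ suc ∘ Fin.inject₁) +F t (suc (Fin.fromℕ q)))
                                                        ≡⟨ cong₂ (λ u v → t zero +F (u +F v)) inner-terms last-term ⟩
    t zero +F (0F +F x ^ n)                             ≡⟨ cong₂ _+F_ first-term (+F-identityˡ (x ^ n)) ⟩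
    1F +F x ^ n                                         ≡⟨ +F-comm 1F (x ^ n) ⟩
    x ^ n +F 1F                                         ∎
    where
    t = binomialTerm x 1F n
    first-term : t zero ≡ 1F
    first-term = begin
      1 × (1F *F 1F ^ n)     ≡⟨ ×-⟦⟧ 1 _ ⟩
      1F *F (1F *F 1F ^ n)   ≡⟨ *F-identityˡ _ ⟩
      1F *F 1F ^ n           ≡⟨ *F-identityˡ _ ⟩
      1F ^ n                 ≡⟨ 1F^ n ⟩
      1F                     ∎
    inner-terms : sum (t ∘ suc ∘ Fin.inject₁) ≡ 0F
    inner-terms = trans (sum-cong-≗ inner-term) (sum-replicate-zero q)
      where
      inner-term : ∀ i → t (suc (Fin.inject₁ i)) ≡ 0F
      inner-term i = begin
        (n C k) × b                ≡⟨ ×-⟦⟧ (n C k) b ⟩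
        ⟦ n C k ⟧ *F b              ≡⟨ cong (_*F b) (∣⇒⟦⟧≡0F (p∣C k (s≤s z≤n) (s≤s k<q))) ⟩
        0F *F b                     ≡⟨ zeroˡ b ⟩
        0F                          ∎
        where
        k = suc (toℕ (Fin.inject₁ i))
        b = x ^ k *F 1F ^ (q ∸ toℕ (Fin.inject₁ i))
        k<q = subst (_< q) (sym (toℕ-inject₁ i)) (toℕ<n i)
    last-term : t (suc (Fin.fromℕ q)) ≡ x ^ n
    last-term = begin
      (n C suc (toℕ (Fin.fromℕ q))) × (x ^ suc (toℕ (Fin.fromℕ q)) *F 1F ^ (q ∸ toℕ (Fin.fromℕ q)))
        ≡⟨ cong (λ k → (n C suc k) × (x ^ suc k *F 1F ^ (q ∸ k))) (toℕ-fromℕ q) ⟩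
      (n C n) × (x ^ n *F 1F ^ (q ∸ q))  ≡⟨ cong₂ (λ c e → c × (x ^ n *F e)) (nCn≡1 n) (1F^ (q ∸ q)) ⟩
      1 × (x ^ n *F 1F)                  ≡⟨ ×-⟦⟧ 1 _ ⟩
      1F *F (x ^ n *F 1F)                ≡⟨ *F-identityˡ _ ⟩
      x ^ n *F 1F                        ≡⟨ *F-comm _ 1F ⟩
      1F *F x ^ n                        ≡⟨ *F-identityˡ _ ⟩
      x ^ n                              ∎

module PrimeField (p : ℕ) .{{_ : NonZero p}} (p-prime : Prime p) where
  open Field p
  open IntegersModulo p
  open ≡-Reasoning
  open CommutativeRing commutativeRing using (zeroˡ; zeroʳ; *-identityʳ)
  open RingProperties (CommutativeRing.ring commutativeRing)
    using (x[y-z]≈xy-xz; x≈y⇒x∙y⁻¹≈ε; x∙y⁻¹≈ε⇒x≈y)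
  open import Algebra.Properties.CommutativeSemiring.Exp
    (CommutativeRing.commutativeSemiring commutativeRing) using (^-distrib-*)

  p>1 : 1 < p
  p>1 = nonTrivial⇒n>1 p {{prime⇒nonTrivial p-prime}}

  p≡2+[p∸2] : p ≡ suc (suc (p ∸ 2))
  p≡2+[p∸2] = sym (ℕ.m+[n∸m]≡n p>1)

  +1-^p : ∀ x → (x +F 1F) ^ p ≡ x ^ p +F 1F
  +1-^p = freshmans-dream p (λ _ → prime∣pCk p-prime)

  fermat : ∀ x → x ^ p ≡ x
  fermat x = subst (λ y → y ^ p ≡ y) (⟦⟧-toℕ x) (fermat-⟦⟧ (toℕ x))
    where
    fermat-⟦⟧ : ∀ m → ⟦ m ⟧ ^ p ≡ ⟦ m ⟧
    fermat-⟦⟧ zero    = trans (cong (0F ^_) p≡2+[p∸2]) (zeroˡ _)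
    fermat-⟦⟧ (suc m) = begin
      ⟦ suc m ⟧ ^ p         ≡⟨ cong (_^ p) ⟦1+m⟧≡⟦m⟧+1 ⟩
      (⟦ m ⟧ +F 1F) ^ p      ≡⟨ +1-^p ⟦ m ⟧ ⟩
      ⟦ m ⟧ ^ p +F 1F        ≡⟨ cong (_+F 1F) (fermat-⟦⟧ m) ⟩
      ⟦ m ⟧ +F 1F            ≡⟨ ⟦1+m⟧≡⟦m⟧+1 ⟨
      ⟦ suc m ⟧              ∎
      where
      ⟦1+m⟧≡⟦m⟧+1 : ⟦ suc m ⟧ ≡ ⟦ m ⟧ +F 1F
      ⟦1+m⟧≡⟦m⟧+1 = trans (cong ⟦_⟧ (ℕ.+-comm 1 m)) (⟦⟧-+ m 1)

  1F≢0F : 1F ≢ 0F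
  1F≢0F 1≡0 = ℕ.<⇒≱ p>1 (∣⇒≤ (⟦⟧≡0F⇒∣ 1≡0))

  xy≡0⇒x≡0⊎y≡0 : ∀ x y → x *F y ≡ 0F → x ≡ 0F ⊎ y ≡ 0F
  xy≡0⇒x≡0⊎y≡0 x y xy≡0 with euclidsLemma (toℕ x) (toℕ y) p-prime (⟦⟧≡0F⇒∣ xy≡0)
  ... | inj₁ p∣x = inj₁ (trans (sym (⟦⟧-toℕ x)) (∣⇒⟦⟧≡0F p∣x))
  ... | inj₂ p∣y = inj₂ (trans (sym (⟦⟧-toℕ y)) (∣⇒⟦⟧≡0F p∣y))

  *F-nonzero : ∀ {x y} → x ≢ 0F → y ≢ 0F → x *F y ≢ 0F
  *F-nonzero {x} {y} x≢0 y≢0 xy≡0 with xy≡0⇒x≡0⊎y≡0 x y xy≡0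
  ... | inj₁ x≡0 = x≢0 x≡0
  ... | inj₂ y≡0 = y≢0 y≡0

  *F-cancelˡ : ∀ {x u v} → x ≢ 0F → x *F u ≡ x *F v → u ≡ v
  *F-cancelˡ {x} {u} {v} x≢0 xu≡xv
    with xy≡0⇒x≡0⊎y≡0 x (u -F v) (trans (x[y-z]≈xy-xz x u v) (x≈y⇒x∙y⁻¹≈ε xu≡xv))
  ... | inj₁ x≡0   = contradiction x≡0 x≢0
  ... | inj₂ u-v≡0 = x∙y⁻¹≈ε⇒x≈y u v u-v≡0

  invF≡^ : ∀ x → invF x ≡ x ^ (p ∸ 2)
  invF≡^ x = trans (⟦⟧-^ (toℕ x) (p ∸ 2)) (cong (_^ (p ∸ 2)) (⟦⟧-toℕ x))

  *F-inverseʳ : ∀ {x} → x ≢ 0F → x *F invF x ≡ 1F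
  *F-inverseʳ {x} x≢0 = *F-cancelˡ x≢0 (begin
    x *F (x *F invF x)         ≡⟨ cong (λ y → x *F (x *F y)) (invF≡^ x) ⟩
    x *F (x *F x ^ (p ∸ 2))    ≡⟨ cong (x ^_) p≡2+[p∸2] ⟨
    x ^ p                      ≡⟨ fermat x ⟩
    x                          ≡⟨ *-identityʳ x ⟨
    x *F 1F                    ∎)

  invF-* : ∀ x y → invF (x *F y) ≡ invF x *F invF y
  invF-* x y = begin
    invF (x *F y)              ≡⟨ invF≡^ (x *F y) ⟩
    (x *F y) ^ (p ∸ 2)         ≡⟨ ^-distrib-* x y (p ∸ 2) ⟩
    x ^ (p ∸ 2) *F y ^ (p ∸ 2) ≡⟨ cong₂ _*F_ (invF≡^ x) (invF≡^ y) ⟨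
    invF x *F invF y           ∎

  invF-nonzero : ∀ {x} → x ≢ 0F → invF x ≢ 0F
  invF-nonzero {x} x≢0 x⁻¹≡0 = 1F≢0F (begin
    1F             ≡⟨ *F-inverseʳ x≢0 ⟨
    x *F invF x    ≡⟨ cong (x *F_) x⁻¹≡0 ⟩
    x *F 0F        ≡⟨ zeroʳ x ⟩
    0F             ∎)

  invF-unique : ∀ {x y} → x ≢ 0F → x *F y ≡ 1F → invF x ≡ y
  invF-unique x≢0 xy≡1 = *F-cancelˡ x≢0 (trans (*F-inverseʳ x≢0) (sym xy≡1))

  invF-involutive : ∀ {x} → x ≢ 0F → invF (invF x) ≡ x
  invF-involutive {x} x≢0 = invF-unique (invF-nonzero x≢0) (trans (*F-comm (invF x) x) (*F-inverseʳ x≢0))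

  open Solver using (solve; _:+_; _:*_; _:-_; con; _:=_)

  /F-*-interchange : ∀ x u y v → (x *F u) /F (y *F v) ≡ (x /F y) *F (u /F v)
  /F-*-interchange x u y v = begin
    (x *F u) *F invF (y *F v)        ≡⟨ cong ((x *F u) *F_) (invF-* y v) ⟩
    (x *F u) *F (invF y *F invF v)   ≡⟨ interchange x u (invF y) (invF v) ⟩
    (x *F invF y) *F (u *F invF v)   ∎
    where open import Algebra.Properties.CommutativeSemigroup
            (CommutativeRing.*-commutativeSemigroup commutativeRing) using (interchange)

  /F-split : ∀ {y v} x u → y ≢ 0F → v ≢ 0F → x /F y ≡ (x *F v -F u *F y) /F (y *F v) +F u /F v
  /F-split {y} {v} x u y≢0 v≢0 = sym (begin
    (x *F v -F u *F y) *F invF (y *F v) +F u *F iv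
      ≡⟨ cong (λ w → (x *F v -F u *F y) *F w +F u *F iv) (invF-* y v) ⟩
    (x *F v -F u *F y) *F (iy *F iv) +F u *F iv
      ≡⟨ solve 6 (λ x u y v iy iv →
           (x :* v :- u :* y) :* (iy :* iv) :+ u :* iv
             := x :* iy :* (v :* iv) :+ u :* iv :* (con (+ 1) :- y :* iy)) refl x u y v iy iv ⟩
    x *F iy *F (v *F iv) +F u *F iv *F (1F -F y *F iy)
      ≡⟨ cong₂ (λ s t → x *F iy *F s +F u *F iv *F (1F -F t)) (*F-inverseʳ v≢0) (*F-inverseʳ y≢0) ⟩
    x *F iy *F 1F +F u *F iv *F (1F -F 1F)
      ≡⟨ solve 3 (λ x iy w → x :* iy :* con (+ 1) :+ w :* (con (+ 1) :- con (+ 1)) := x :* iy)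
               refl x iy (u *F iv) ⟩
    x *F iy ∎)
    where
    iy = invF y
    iv = invF v

  /F-*-cancel : ∀ {y} x → y ≢ 0F → x /F y *F y ≡ x
  /F-*-cancel {y} x y≢0 = begin
    x *F invF y *F y     ≡⟨ solve 3 (λ x y iy → x :* iy :* y := x :* (y :* iy)) refl x y (invF y) ⟩
    x *F (y *F invF y)   ≡⟨ cong (x *F_) (*F-inverseʳ y≢0) ⟩
    x *F 1F              ≡⟨ *-identityʳ x ⟩
    x                    ∎

  affine-parameter : ∀ {α} x β → α ≢ 0F → x ≡ α *F ((x -F β) /F α) +F β
  affine-parameter {α} x β α≢0 = sym (begin
    α *F ((x -F β) /F α) +F β    ≡⟨ cong (_+F β) (trans (*F-comm α _) (/F-*-cancel (x -F β) α≢0)) ⟩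
    x -F β +F β                  ≡⟨ solve 2 (λ x β → x :- β :+ β := x) refl x β ⟩
    x                            ∎)

module Möbius (p : ℕ) .{{_ : NonZero p}} (p-prime : Prime p) where
  open Field p
  open IntegersModulo p using (*F-comm; module Solver)
  open PrimeField p p-prime
  open RingProperties (CommutativeRing.ring (IntegersModulo.commutativeRing p)) using (-‿distribˡ-*)
  open Solver using (solve; _:+_; _:*_; _:-_; :-_; con; _:=_)
  open ≡-Reasoning

  act-finite : ∀ {a b c d z} → c *F z +F d ≢ 0F →
               act (mat a b c d) (just z) ≡ just (möb (mat a b c d) z)
  act-finite {a} {b} {c} {d} {z} D≢0 =
    cong (λ t → if t then nothing else just (möb (mat a b c d) z)) (dec-false ((c *F z +F d) ≟F 0F) D≢0)

  denominator≡0⇒pole : ∀ {c d z} → c ≢ 0F → c *F z +F d ≡ 0F → z ≡ negF (d /F c)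
  denominator≡0⇒pole {c} {d} {z} c≢0 D≡0 = *F-cancelˡ c≢0 (begin
    c *F z                    ≡⟨ solve 3 (λ c d z → c :* z := (c :* z :+ d) :- d) refl c d z ⟩
    (c *F z +F d) -F d        ≡⟨ cong (_-F d) D≡0 ⟩
    0F -F d                   ≡⟨ solve 1 (λ d → con (+ 0) :- d := (:- d) :* con (+ 1)) refl d ⟩
    negF d *F 1F              ≡⟨ cong (negF d *F_) (*F-inverseʳ c≢0) ⟨
    negF d *F (c *F invF c)   ≡⟨ solve 3 (λ c d ic → (:- d) :* (c :* ic) := c :* (:- (d :* ic)))
                                         refl c d (invF c) ⟩
    c *F negF (d /F c)        ∎)

  denominator-at-pole-shift : ∀ {c d} x → c ≢ 0F → c *F (x +F negF (d /F c)) +F d ≡ c *F x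
  denominator-at-pole-shift {c} {d} x c≢0 = begin
    c *F (x +F negF (d *F invF c)) +F d
      ≡⟨ solve 4 (λ c d x ic → c :* (x :+ (:- (d :* ic))) :+ d := c :* x :+ d :* (con (+ 1) :- c :* ic))
               refl c d x (invF c) ⟩
    c *F x +F d *F (1F -F c *F invF c)
      ≡⟨ cong (λ t → c *F x +F d *F (1F -F t)) (*F-inverseʳ c≢0) ⟩
    c *F x +F d *F (1F -F 1F)
      ≡⟨ solve 3 (λ c d x → c :* x :+ d :* (con (+ 1) :- con (+ 1)) := c :* x) refl c d x ⟩
    c *F x ∎

  möb-via-∞ : ∀ {a b c d} z → c ≢ 0F → c *F z +F d ≢ 0F →
              möb (mat a b c d) z ≡ negF (det (mat a b c d) /F (c *F (c *F z +F d))) +F a /F c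
  möb-via-∞ {a} {b} {c} {d} z c≢0 D≢0 = begin
    (a *F z +F b) /F D
      ≡⟨ /F-split (a *F z +F b) a D≢0 c≢0 ⟩
    ((a *F z +F b) *F c -F a *F D) /F (D *F c) +F a /F c
      ≡⟨ cong₂ (λ n m → n /F m +F a /F c) numerator (*F-comm D c) ⟩
    negF (a *F d -F b *F c) /F (c *F D) +F a /F c
      ≡⟨ cong (_+F a /F c) (-‿distribˡ-* (a *F d -F b *F c) (invF (c *F D))) ⟨
    negF ((a *F d -F b *F c) /F (c *F D)) +F a /F c ∎
    where
    D = c *F z +F d
    numerator : (a *F z +F b) *F c -F a *F D ≡ negF (a *F d -F b *F c)
    numerator = solve 5 (λ a b c d z → (a :* z :+ b) :* c :- a :* (c :* z :+ d) := :- (a :* d :- b :* c))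
                        refl a b c d z

  möb-via-finite : ∀ {a b c d} z w → c *F z +F d ≢ 0F → c *F w +F d ≢ 0F →
                   möb (mat a b c d) z ≡ det (mat a b c d) *F (z -F w) /F ((c *F z +F d) *F (c *F w +F d))
                                            +F möb (mat a b c d) w
  möb-via-finite {a} {b} {c} {d} z w Dz≢0 Dw≢0 = begin
    (a *F z +F b) /F Dz
      ≡⟨ /F-split (a *F z +F b) (a *F w +F b) Dz≢0 Dw≢0 ⟩
    ((a *F z +F b) *F Dw -F (a *F w +F b) *F Dz) /F (Dz *F Dw) +F (a *F w +F b) /F Dw
      ≡⟨ cong (λ n → n /F (Dz *F Dw) +F (a *F w +F b) /F Dw) numerator ⟩
    (a *F d -F b *F c) *F (z -F w) /F (Dz *F Dw) +F (a *F w +F b) /F Dw ∎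
    where
    Dz = c *F z +F d
    Dw = c *F w +F d
    numerator : (a *F z +F b) *F Dw -F (a *F w +F b) *F Dz ≡ (a *F d -F b *F c) *F (z -F w)
    numerator = solve 6 (λ a b c d z w → (a :* z :+ b) :* (c :* w :+ d) :- (a :* w :+ b) :* (c :* z :+ d)
                                          := (a :* d :- b :* c) :* (z :- w))
                        refl a b c d z w

module ImageOfGammaSet
  (p : ℕ) .{{_ : NonZero p}} (p-prime : Prime p)
  (Γ : Field.F p → Set) (Γ-subgroup : Field.IsMulSubgroup p Γ)
  (a b c d : Field.F p)
  (det≢0 : Field.det p (Field.mat a b c d) ≢ Field.0F p) (c≢0 : c ≢ Field.0F p)
  (m : ℕ) (α : Fin (suc m) → Field.F p) (α≢0 : ∀ i → α i ≢ Field.0F p)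
  (β : Fin (suc m) → Field.F p) (β₁≡pole : β zero ≡ Field.negF p (Field._/F_ p d c))
  (βⱼ≢pole : ∀ j → β (suc j) ≢ Field.negF p (Field._/F_ p d c))
  where
  open Field p
  open IntegersModulo p using (*F-assoc; *F-identityˡ; commutativeRing; module Solver)
  open PrimeField p p-prime
  open Möbius p p-prime
  open CommutativeRing commutativeRing using (*-identityʳ)
  open RingProperties (CommutativeRing.ring commutativeRing) using (-‿distribˡ-*; +-cancelʳ)
  open Solver using (solve; _:+_; _:*_; _:-_; _:=_)
  open IsMulSubgroup Γ-subgroup
  open ≡-Reasoning

  g : Mat
  g = mat a b c d

  γ β′ : Fin (suc m) → F
  γ  = gammaCoeffs g α β
  β′ = newShifts g β

  Γ-nonzero : ∀ {y} → Γ y → y ≢ 0F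
  Γ-nonzero Γy y≡0 = zero∉ (subst Γ y≡0 Γy)

  denominator-βⱼ≢0 : ∀ j → c *F β (suc j) +F d ≢ 0F
  denominator-βⱼ≢0 j D≡0 = βⱼ≢pole j (denominator≡0⇒pole c≢0 D≡0)

  γⱼ≢0 : ∀ j → γ (suc j) ≢ 0F
  γⱼ≢0 j = *F-nonzero (*F-nonzero (α≢0 (suc j)) det≢0)
                      (invF-nonzero (*F-nonzero (*F-nonzero (α≢0 zero) c≢0) (denominator-βⱼ≢0 j)))

  first-coset : F → F
  first-coset y = α zero *F y +F β zero

  denominator-first-coset : ∀ y → c *F first-coset y +F d ≡ c *F α zero *F y
  denominator-first-coset y = begin
    c *F (α zero *F y +F β zero) +F d          ≡⟨ cong (λ t → c *F (α zero *F y +F t) +F d) β₁≡pole ⟩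
    c *F (α zero *F y +F negF (d /F c)) +F d   ≡⟨ denominator-at-pole-shift (α zero *F y) c≢0 ⟩
    c *F (α zero *F y)                         ≡⟨ *F-assoc c (α zero) y ⟨
    c *F α zero *F y                           ∎

  denominator-first-coset≢0 : ∀ {y} → y ≢ 0F → c *F first-coset y +F d ≢ 0F
  denominator-first-coset≢0 {y} y≢0 D≡0 =
    *F-nonzero (*F-nonzero c≢0 (α≢0 zero)) y≢0 (trans (sym (denominator-first-coset y)) D≡0)

  act-first-coset : ∀ {y} → y ≢ 0F → act g (just (first-coset y)) ≡ just (möb g (first-coset y))
  act-first-coset y≢0 = act-finite {a} {b} {c} {d} (denominator-first-coset≢0 y≢0)

  möb-first-coset₁ : ∀ {y} → y ≢ 0F → möb g (first-coset y) ≡ γ zero *F invF y +F β′ zero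
  möb-first-coset₁ {y} y≢0 = begin
    möb g (first-coset y)
      ≡⟨ möb-via-∞ {a} {b} (first-coset y) c≢0 (denominator-first-coset≢0 y≢0) ⟩
    negF (det g /F (c *F (c *F first-coset y +F d))) +F a /F c
      ≡⟨ cong (λ t → negF t +F a /F c) ratio ⟩
    negF (δ *F invF y) +F a /F c
      ≡⟨ cong (_+F a /F c) (-‿distribˡ-* δ (invF y)) ⟩
    γ zero *F invF y +F β′ zero ∎
    where
    δ = det g /F (c *F c *F α zero)
    ratio : det g /F (c *F (c *F first-coset y +F d)) ≡ δ *F invF y
    ratio = begin
      det g /F (c *F (c *F first-coset y +F d))
        ≡⟨ cong₂ _/F_ (sym (*-identityʳ (det g))) (cong (c *F_) (denominator-first-coset y)) ⟩
      (det g *F 1F) /F (c *F (c *F α zero *F y))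
        ≡⟨ cong ((det g *F 1F) /F_) (solve 3 (λ c α₁ y → c :* (c :* α₁ :* y) := c :* c :* α₁ :* y)
                                            refl c (α zero) y) ⟩
      (det g *F 1F) /F (c *F c *F α zero *F y)
        ≡⟨ /F-*-interchange (det g) 1F (c *F c *F α zero) y ⟩
      δ *F (1F /F y)
        ≡⟨ cong (δ *F_) (*F-identityˡ (invF y)) ⟩
      δ *F invF y ∎

  möb-first-cosetⱼ : ∀ {y} j ŷ → y ≢ 0F → first-coset y ≡ α (suc j) *F ŷ +F β (suc j) →
                     möb g (first-coset y) ≡ γ (suc j) *F (ŷ *F invF y) +F β′ (suc j)
  möb-first-cosetⱼ {y} j ŷ y≢0 x≡ = begin
    möb g x
      ≡⟨ möb-via-finite {a} {b} x βⱼ (denominator-first-coset≢0 y≢0) (denominator-βⱼ≢0 j) ⟩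
    det g *F (x -F βⱼ) /F ((c *F x +F d) *F Dβⱼ) +F möb g βⱼ
      ≡⟨ cong (_+F möb g βⱼ) (cong₂ _/F_ numerator denominator) ⟩
    (αⱼ *F det g *F ŷ) /F (α zero *F c *F Dβⱼ *F y) +F möb g βⱼ
      ≡⟨ cong (_+F möb g βⱼ) (/F-*-interchange (αⱼ *F det g) ŷ (α zero *F c *F Dβⱼ) y) ⟩
    γ (suc j) *F (ŷ *F invF y) +F β′ (suc j) ∎
    where
    x = first-coset y
    αⱼ = α (suc j)
    βⱼ = β (suc j)
    Dβⱼ = c *F βⱼ +F d
    numerator : det g *F (x -F βⱼ) ≡ αⱼ *F det g *F ŷ
    numerator = begin
      det g *F (x -F βⱼ)                ≡⟨ cong (λ t → det g *F (t -F βⱼ)) x≡ ⟩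
      det g *F (αⱼ *F ŷ +F βⱼ -F βⱼ)    ≡⟨ solve 4 (λ δ αⱼ ŷ βⱼ → δ :* (αⱼ :* ŷ :+ βⱼ :- βⱼ) := αⱼ :* δ :* ŷ)
                                                  refl (det g) αⱼ ŷ βⱼ ⟩
      αⱼ *F det g *F ŷ                  ∎
    denominator : (c *F x +F d) *F Dβⱼ ≡ α zero *F c *F Dβⱼ *F y
    denominator = begin
      (c *F x +F d) *F Dβⱼ              ≡⟨ cong (_*F Dβⱼ) (denominator-first-coset y) ⟩
      c *F α zero *F y *F Dβⱼ           ≡⟨ solve 4 (λ c α₁ y D → c :* α₁ :* y :* D := α₁ :* c :* D :* y)
                                                  refl c (α zero) y Dβⱼ ⟩
      α zero *F c *F Dβⱼ *F y           ∎

  image⊆ : ∀ w → image g (GammaSet Γ α β) w → embed (GammaSet Γ γ β′) w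
  image⊆ w (x , x∈ , gx≡w) with x∈ zero
  ... | y , Γy , refl = möb g (first-coset y) , gx∈ , trans (sym (act-first-coset y≢0)) gx≡w
    where
    y≢0 = Γ-nonzero Γy
    gx∈ : GammaSet Γ γ β′ (möb g (first-coset y))
    gx∈ zero = invF y , inv-closed Γy , möb-first-coset₁ y≢0
    gx∈ (suc j) with x∈ (suc j)
    ... | yⱼ , Γyⱼ , x≡ = yⱼ *F invF y , *-closed Γyⱼ (inv-closed Γy) , möb-first-cosetⱼ j yⱼ y≢0 x≡

  ⊆image : ∀ w → embed (GammaSet Γ γ β′) w → image g (GammaSet Γ α β) w
  ⊆image w (z , z∈ , z≡w) with z∈ zero
  ... | y′ , Γy′ , z≡ = first-coset y , x∈ , trans (act-first-coset y≢0) (trans (cong just gx≡z) z≡w)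
    where
    y = invF y′
    Γy = inv-closed Γy′
    y≢0 = Γ-nonzero Γy
    gx≡z : möb g (first-coset y) ≡ z
    gx≡z = begin
      möb g (first-coset y)          ≡⟨ möb-first-coset₁ y≢0 ⟩
      γ zero *F invF y +F β′ zero    ≡⟨ cong (λ t → γ zero *F t +F β′ zero) (invF-involutive (Γ-nonzero Γy′)) ⟩
      γ zero *F y′ +F β′ zero        ≡⟨ z≡ ⟨
      z                              ∎
    x∈ : GammaSet Γ α β (first-coset y)
    x∈ zero = y , Γy , refl
    x∈ (suc j) with z∈ (suc j)
    ... | yⱼ′ , Γyⱼ′ , z≡ⱼ = yⱼ′ *F y , *-closed Γyⱼ′ Γy , x≡
      where
      ŷ = (first-coset y -F β (suc j)) /F α (suc j)
      x≡ŷ : first-coset y ≡ α (suc j) *F ŷ +F β (suc j)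
      x≡ŷ = affine-parameter (first-coset y) (β (suc j)) (α≢0 (suc j))
      ŷ/y≡yⱼ′ : ŷ /F y ≡ yⱼ′
      ŷ/y≡yⱼ′ = *F-cancelˡ (γⱼ≢0 j) (+-cancelʳ (β′ (suc j)) _ _
                  (trans (sym (möb-first-cosetⱼ j ŷ y≢0 x≡ŷ)) (trans gx≡z z≡ⱼ)))
      x≡ : first-coset y ≡ α (suc j) *F (yⱼ′ *F y) +F β (suc j)
      x≡ = trans x≡ŷ (cong (λ t → α (suc j) *F t +F β (suc j))
                           (trans (sym (/F-*-cancel ŷ y≢0)) (cong (_*F y) ŷ/y≡yⱼ′)))

lemma20 : (p : ℕ) .{{_ : NonZero p}} → Prime p →
    (Γ : Field.F p → Set) → Field.IsMulSubgroup p Γ →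
    (a b c d : Field.F p) →
    Field.det p (Field.mat a b c d) ≢ Field.0F p → c ≢ Field.0F p →
    (m : ℕ) → 1 ≤ m →
    (α : Fin (suc m) → Field.F p) → (∀ i → α i ≢ Field.0F p) →
    (β : Fin (suc m) → Field.F p) →
    β zero ≡ Field.negF p (Field._/F_ p d c) →
    (∀ (j : Fin m) → β (suc j) ≢ Field.negF p (Field._/F_ p d c)) →
    ∀ (w : Field.P¹ p) →
      Field.image p (Field.mat a b c d) (Field.GammaSet p Γ α β) w
      ⇔ Field.embed p (Field.GammaSet p Γ
            (Field.gammaCoeffs p (Field.mat a b c d) α β)
            (Field.newShifts p (Field.mat a b c d) β)) w
lemma20 p p-prime Γ Γ-subgroup a b c d det≢0 c≢0 m _ α α≢0 β β₁≡pole βⱼ≢pole w =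
  mk⇔ (image⊆ w) (⊆image w)
  where open ImageOfGammaSet p p-prime Γ Γ-subgroup a b c d det≢0 c≢0 m α α≢0 β β₁≡pole βⱼ≢pole
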